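{- Let $G_1,G_2$ be graphs, let $b,b'\in V(G_2)$ be two distinct true twin vertices of $G_2$, and let $a\in V(G_1)$. Then the vertices $(a,b)$ and $(a,b')$ are true twins in $G_1*G_2$ if and only if $a$ is a dominating vertex of $G_1$.
   Context: All graphs are finite and simple. For graphs $G_1,G_2$, the co-normal product $G_1*G_2$ is the graph with vertex set $V(G_1)\times V(G_2)$ in which $(a,b)$ and $(c,d)$ are adjacent if and only if $a$ is adjacent to $c$ in $G_1$ or $b$ is adjacent to $d$ in $G_2$. Two distinct vertices $u,v$ are true twins if $N[u]=N[v]$ (closed neighborhoods). A dominating vertex of $G$ is a vertex of degree $|V(G)|-1$. -}

module Defs where

open import Data.Nat using (ℕ)
open import Data.Fin using (Fin)
open import Data.Product using (_×_; _,_; proj₁; proj₂)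
open import Data.Sum using (_⊎_)
open import Relation.Nullary using (¬_; Dec)
open import Relation.Binary.PropositionalEquality using (_≡_; _≢_)
open import Function.Bundles using (_⇔_)

record Graph (n : ℕ) : Set₁ where
  field
    Adj   : Fin n → Fin n → Set
    adj?  : ∀ u v → Dec (Adj u v)
    irrefl : ∀ u → ¬ Adj u u
    sym   : ∀ {u v} → Adj u v → Adj v u
open Graph public

InClosedNbhd : ∀ {A : Set} → (A → A → Set) → A → A → Set
InClosedNbhd R u w = (w ≡ u) ⊎ R u w

TrueTwins : ∀ {A : Set} → (A → A → Set) → A → A → Set
TrueTwins {A} R u v = (u ≢ v) × (∀ (w : A) → InClosedNbhd R u w ⇔ InClosedNbhd R v w)

Dominating : ∀ {n} → Graph n → Fin n → Set
Dominating G a = ∀ w → w ≢ a → Adj G a w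

CoNormalAdj : ∀ {n m} → Graph n → Graph m → (Fin n × Fin m) → (Fin n × Fin m) → Set
CoNormalAdj G₁ G₂ (a , b) (c , d) = Adj G₁ a c ⊎ Adj G₂ b d

-- In G₁ * G₂ a vertex
-- (c , d) off the fibre {a} × V(G₂) lies in N[(a , x)] exactly when a ~ c or
-- x ~ d, while inside the fibre (c = a) irreflexivity of G₁ makes
-- (a , d) ∈ N[(a , x)] equivalent to d ∈ N[x] in G₂.
--
-- (⇐) If a is dominating, every vertex off the fibre is adjacent to both
--     (a , b) and (a , b'), and inside the fibre the neighbourhoods agree
--     because N[b] = N[b'].  Hence for c ≠ a the
--     vertex (c , b) is a neighbour of (a , b'), thus of (a , b); as b ≁ b,
--     this forces a ~ c.
module Submission where

open import Defs
open import Data.Fin using (Fin)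
open import Data.Fin.Properties using (_≟_)
open import Data.Product using (_×_; _,_; proj₁; proj₂)
open import Data.Sum using (inj₁; inj₂)
open import Data.Empty using (⊥-elim)
open import Relation.Nullary using (yes; no)
open import Relation.Binary.PropositionalEquality using (_≢_; refl; cong) renaming (sym to ≡-sym)
open import Function.Bundles using (_⇔_; mk⇔; Equivalence)

_⊆N_within_ : ∀ {A : Set} → A → A → (A → A → Set) → Set
u ⊆N v within R = ∀ w → InClosedNbhd R u w → InClosedNbhd R v w

-- Distinct true twins are adjacent: v lies in N[v] = N[u] and v ≠ u.
twins-adjacent : ∀ {A : Set} (R : A → A → Set) {u v : A} →
  TrueTwins R u v → R u v
twins-adjacent R (u≢v , same) with Equivalence.from (same _) (inj₁ refl)
... | inj₁ v≡u = ⊥-elim (u≢v (≡-sym v≡u))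
... | inj₂ uv  = uv

module _ {n m} (G₁ : Graph n) (G₂ : Graph m) where

  N[_]∋_ : Fin n × Fin m → Fin n × Fin m → Set
  N[ u ]∋ w = InClosedNbhd (CoNormalAdj G₁ G₂) u w

  -- Inside the fibre over a, the product neighbourhood is that of G₂:
  -- the G₁-component can never contribute since G₁ has no loops.
  fibre-nbhd : ∀ a x d → N[ a , x ]∋ (a , d) ⇔ InClosedNbhd (Adj G₂) x d
  fibre-nbhd a x d = mk⇔ to from
    where
    to : N[ a , x ]∋ (a , d) → InClosedNbhd (Adj G₂) x d
    to (inj₁ refl)        = inj₁ refl
    to (inj₂ (inj₁ a~a))  = ⊥-elim (irrefl G₁ a a~a)
    to (inj₂ (inj₂ x~d))  = inj₂ x~d

    from : InClosedNbhd (Adj G₂) x d → N[ a , x ]∋ (a , d)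
    from (inj₁ refl) = inj₁ refl
    from (inj₂ x~d)  = inj₂ (inj₂ x~d)

  -- Over a dominating vertex a, neighbourhood inclusion in G₂ lifts to the
  -- fibre: off the fibre everything is adjacent to (a , x'), and inside the
  -- fibre we transport along `fibre-nbhd`.
  fibre-nbhd-mono : ∀ {a x x'} → Dominating G₁ a →
    x ⊆N x' within Adj G₂ →
    (a , x) ⊆N (a , x') within CoNormalAdj G₁ G₂
  fibre-nbhd-mono {a} {x} {x'} dom x⊆x' (c , d) c,d∈N with c ≟ a
  ... | no c≢a   = inj₂ (inj₁ (dom c c≢a))
  ... | yes refl = Equivalence.from (fibre-nbhd a x' d)
                     (x⊆x' d (Equivalence.to (fibre-nbhd a x d) c,d∈N))

  -- If (a , x) and (a , x') are true twins and x' ~ x, then a is dominating: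
  -- for c ≠ a the neighbour (c , x) of (a , x') must be a neighbour of
  -- (a , x), and as x ≁ x this can only be through a ~ c.
  dominating-from-fibre-twins : ∀ {a x x'} →
    TrueTwins (CoNormalAdj G₁ G₂) (a , x) (a , x') → Adj G₂ x' x →
    Dominating G₁ a
  dominating-from-fibre-twins {a} {x} (_ , same) x'~x c c≢a
    with Equivalence.from (same (c , x)) (inj₂ (inj₂ x'~x))
  ... | inj₁ c,x≡a,x   = ⊥-elim (c≢a (cong proj₁ c,x≡a,x))
  ... | inj₂ (inj₁ a~c) = a~c
  ... | inj₂ (inj₂ x~x) = ⊥-elim (irrefl G₂ x x~x)

proposition2p8 : ∀ {n m} (G₁ : Graph n) (G₂ : Graph m) (b b' : Fin m) (a : Fin n) →
    b ≢ b' → TrueTwins (Adj G₂) b b' →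
    TrueTwins (CoNormalAdj G₁ G₂) (a , b) (a , b') ⇔ Dominating G₁ a
proposition2p8 G₁ G₂ b b' a b≢b' twins@(_ , same) = mk⇔ to from
  where
  b'~b : Adj G₂ b' b
  b'~b = sym G₂ (twins-adjacent (Adj G₂) twins)

  to : TrueTwins (CoNormalAdj G₁ G₂) (a , b) (a , b') → Dominating G₁ a
  to fibreTwins = dominating-from-fibre-twins G₁ G₂ fibreTwins b'~b

  from : Dominating G₁ a → TrueTwins (CoNormalAdj G₁ G₂) (a , b) (a , b')
  from dom = (λ ab≡ab' → b≢b' (cong proj₂ ab≡ab'))
           , λ w → mk⇔ (fibre-nbhd-mono G₁ G₂ dom (λ d → Equivalence.to (same d)) w)
                       (fibre-nbhd-mono G₁ G₂ dom (λ d → Equivalence.from (same d)) w)
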